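{- Let $h$ be a positive integer and $G$ a graph. Let $\mathcal{A}_h$ be the set of $(h,h)$-good vertices and $\mathcal{B}_h$ the set of $(h,h)$-bad vertices of $G$. Then $\sum_{x\in\mathcal{B}_h} d(x)\leq \frac{2}{3}e(G)$ and $\sum_{x\in\mathcal{A}_h} d(x)\geq \frac{4}{3}e(G)$.
   Context: Let $G$ be a (nonempty) graph with average degree $D$, and $h$ a positive integer. A vertex $x$ is $(h,1)$-good if $d(x)\geq D/3^h$. For $i=2,\dots,h$, a vertex $x$ is $(h,i)$-good if it is $(h,1)$-good and at least half of its neighbors are $(h,i-1)$-good. A vertex that is not $(h,i)$-good is $(h,i)$-bad. -}

module Defs where

open import Data.Nat using (ℕ; zero; suc; _+_; _*_; _∸_; _^_; _≤ᵇ_; _<ᵇ_)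
open import Data.Bool using (Bool; true; false; _∧_; if_then_else_; not)
open import Data.Fin using (Fin; toℕ)
open import Data.List using (List; map; allFin)
open import Data.Nat.ListAction using (sum)
open import Relation.Binary.PropositionalEquality using (_≡_)

record SimpleGraph (n : ℕ) : Set where
  field
    adj     : Fin n → Fin n → Bool
    symm    : ∀ x y → adj x y ≡ adj y x
    irrefl  : ∀ x → adj x x ≡ false
open SimpleGraph public

sumV : {n : ℕ} → (Fin n → ℕ) → ℕ
sumV {n} f = sum (map f (allFin n))

ind : Bool → ℕ
ind b = if b then 1 else 0

deg : {n : ℕ} → SimpleGraph n → Fin n → ℕ
deg G x = sumV (λ y → ind (adj G x y))

edges : {n : ℕ} → SimpleGraph n → ℕ
edges G = sumV (λ x → sumV (λ y → ind ((toℕ x <ᵇ toℕ y) ∧ adj G x y)))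

degSum : {n : ℕ} → SimpleGraph n → ℕ
degSum G = sumV (deg G)

-- (h,1)-good:  d(x) ≥ D / 3^h  with D = degSum / n,
-- i.e. (cleared of denominators, n ≥ 1)  degSum ≤ 3^h * n * d(x)
good1 : {n : ℕ} → SimpleGraph n → ℕ → Fin n → Bool
good1 {n} G h x = degSum G ≤ᵇ (3 ^ h) * n * deg G x

-- goodFrom G h k x  ==  x is (h, k+1)-good   (index shifted by one)
-- (h,i)-good, i ≥ 2: (h,1)-good and at least half of the neighbours
-- are (h,i-1)-good, i.e. d(x) ≤ 2 * #{neighbours y that are (h,i-1)-good}
goodFrom : {n : ℕ} → SimpleGraph n → ℕ → ℕ → Fin n → Bool
goodFrom G h zero    x = good1 G h x
goodFrom G h (suc k) x =
  good1 G h x ∧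
  (deg G x ≤ᵇ 2 * sumV (λ y → ind (adj G x y ∧ goodFrom G h k y)))

isGood : {n : ℕ} → SimpleGraph n → (h i : ℕ) → Fin n → Bool
isGood G h i x = goodFrom G h (i ∸ 1) x

sumDegGood : {n : ℕ} → SimpleGraph n → ℕ → ℕ
sumDegGood G h = sumV (λ x → if isGood G h h x then deg G x else 0)

sumDegBad : {n : ℕ} → SimpleGraph n → ℕ → ℕ
sumDegBad G h = sumV (λ x → if isGood G h h x then 0 else deg G x)

-- Let Bₖ be the degree sum of the (h,k+1)-bad vertices. Every (h,1)-bad
-- vertex has degree below D/3ʰ, so 3ʰ B₀ ≤ nD = 2e. A vertex that is
-- (h,1)-good but (h,k+2)-bad has more than half of its neighbours
-- (h,k+1)-bad, so its degree is at most twice the number of such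
-- neighbours; summing, and double counting the edges into (h,k+1)-bad
-- vertices, gives Bₖ₊₁ ≤ B₀ + 2 Bₖ. Hence 3ʰ Bₖ ≤ (2ᵏ⁺¹ - 1) · 2e, and at
-- k = h - 1 the estimate 2ʰ ≤ 3ʰ⁻¹ + 1 yields 3 B ≤ 2e. The bound for the
-- good vertices follows, as their degrees sum to 2e - B.
module Submission where

open import Defs
open import Data.Bool using (Bool; true; false; _∧_; not; if_then_else_)
open import Data.Bool.Properties using (∧-zeroʳ; ∧-identityʳ)
open import Data.Fin using (Fin; toℕ)
import Data.Fin as Fin
open import Data.Fin.Properties using (toℕ-injective)
open import Data.List using (tabulate)
open import Data.List.Properties using (map-tabulate)
import Data.Nat.ListAction as List
open import Data.Nat
open import Data.Nat.Properties
open import Data.Nat.Solver using (module +-*-Solver)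
open import Data.Product using (_×_; _,_)
open import Function using (_∘_; id)
open import Relation.Binary.PropositionalEquality
open import Relation.Nullary.Reflects using (ofʸ; ofⁿ)
open import Relation.Nullary.Negation using (contradiction)
open import Algebra.Properties.Semiring.Sum +-*-semiring
  using (sum; sum-cong-≗; ∑-distrib-+; ∑-comm; *-distribˡ-sum)

open +-*-Solver

sum-tabulate : ∀ {n} (f : Fin n → ℕ) → List.sum (tabulate f) ≡ sum f
sum-tabulate {zero}  f = refl
sum-tabulate {suc n} f = cong (f Fin.zero +_) (sum-tabulate (f ∘ Fin.suc))

sumV≡sum : ∀ {n} (f : Fin n → ℕ) → sumV f ≡ sum f
sumV≡sum f = trans (cong List.sum (map-tabulate id f)) (sum-tabulate f)

sum-mono-≤ : ∀ {n} {f g : Fin n → ℕ} → (∀ x → f x ≤ g x) → sum f ≤ sum g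
sum-mono-≤ {zero}  f≤g = z≤n
sum-mono-≤ {suc n} f≤g = +-mono-≤ (f≤g Fin.zero) (sum-mono-≤ (f≤g ∘ Fin.suc))

sum-const : ∀ {n} c → sum {n} (λ _ → c) ≡ n * c
sum-const {zero}  c = refl
sum-const {suc n} c = cong (c +_) (sum-const {n} c)

module _ {n : ℕ} where

  sumV-cong : {f g : Fin n → ℕ} → (∀ x → f x ≡ g x) → sumV f ≡ sumV g
  sumV-cong {f} {g} f≗g = trans (sumV≡sum f) (trans (sum-cong-≗ f≗g) (sym (sumV≡sum g)))

  sumV-mono-≤ : {f g : Fin n → ℕ} → (∀ x → f x ≤ g x) → sumV f ≤ sumV g
  sumV-mono-≤ {f} {g} f≤g =
    subst₂ _≤_ (sym (sumV≡sum f)) (sym (sumV≡sum g)) (sum-mono-≤ f≤g)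

  sumV-+ : (f g : Fin n → ℕ) → sumV (λ x → f x + g x) ≡ sumV f + sumV g
  sumV-+ f g = begin
    sumV (λ x → f x + g x)  ≡⟨ sumV≡sum {n} _ ⟩
    sum (λ x → f x + g x)   ≡⟨ ∑-distrib-+ f g ⟩
    sum f + sum g           ≡⟨ sym (cong₂ _+_ (sumV≡sum f) (sumV≡sum g)) ⟩
    sumV f + sumV g         ∎
    where open ≡-Reasoning

  sumV-*ˡ : ∀ c (f : Fin n → ℕ) → sumV (λ x → c * f x) ≡ c * sumV f
  sumV-*ˡ c f = begin
    sumV (λ x → c * f x)  ≡⟨ sumV≡sum {n} _ ⟩
    sum (λ x → c * f x)   ≡⟨ sym (*-distribˡ-sum c f) ⟩
    c * sum f             ≡⟨ sym (cong (c *_) (sumV≡sum f)) ⟩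
    c * sumV f            ∎
    where open ≡-Reasoning

  sumV-const : ∀ c → sumV {n} (λ _ → c) ≡ n * c
  sumV-const c = trans (sumV≡sum {n} _) (sum-const {n} c)

  sumV-comm : (F : Fin n → Fin n → ℕ) →
    sumV (λ x → sumV (F x)) ≡ sumV (λ y → sumV (λ x → F x y))
  sumV-comm F = begin
    sumV (λ x → sumV (F x))              ≡⟨ sumV-cong (λ x → sumV≡sum (F x)) ⟩
    sumV (λ x → sum (F x))               ≡⟨ sumV≡sum {n} _ ⟩
    sum (λ x → sum (F x))                ≡⟨ ∑-comm F ⟩
    sum (λ y → sum (λ x → F x y))        ≡⟨ sym (sumV≡sum {n} _) ⟩
    sumV (λ y → sum (λ x → F x y))       ≡⟨ sym (sumV-cong (λ y → sumV≡sum {n} _)) ⟩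
    sumV (λ y → sumV (λ x → F x y))      ∎
    where open ≡-Reasoning

2^[1+k]≤3^k+1 : ∀ k → 2 ^ suc k ≤ 3 ^ k + 1
2^[1+k]≤3^k+1 zero    = ≤-refl
2^[1+k]≤3^k+1 (suc k) = begin
  2 * 2 ^ suc k          ≤⟨ *-monoʳ-≤ 2 (2^[1+k]≤3^k+1 k) ⟩
  2 * (3 ^ k + 1)        ≡⟨ solve 1 (λ a → con 2 :* (a :+ con 1) := con 1 :+ (con 2 :* a :+ con 1)) refl (3 ^ k) ⟩
  1 + (2 * 3 ^ k + 1)    ≤⟨ +-monoˡ-≤ (2 * 3 ^ k + 1) (m^n>0 3 k) ⟩
  3 ^ k + (2 * 3 ^ k + 1) ≡⟨ solve 1 (λ a → a :+ (con 2 :* a :+ con 1) := con 3 :* a :+ con 1) refl (3 ^ k) ⟩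
  3 ^ suc k + 1          ∎
  where open ≤-Reasoning

-- Unrolling aₖ₊₁ ≤ a₀ + 2aₖ gives aₖ ≤ (2ᵏ⁺¹ - 1) a₀; the form below avoids
-- the subtraction.
affine-doubling-bound : (a : ℕ → ℕ) {c D : ℕ} → c * a 0 ≤ D →
  (∀ k → a (suc k) ≤ a 0 + 2 * a k) → ∀ k → c * a k + D ≤ 2 ^ suc k * D
affine-doubling-bound a {c} {D} ca₀≤D step zero = begin
  c * a 0 + D  ≤⟨ +-monoˡ-≤ D ca₀≤D ⟩
  D + D        ≡⟨ cong (D +_) (sym (+-identityʳ D)) ⟩
  2 * D        ∎
  where open ≤-Reasoning
affine-doubling-bound a {c} {D} ca₀≤D step (suc k) = begin
  c * a (suc k) + D              ≤⟨ +-monoˡ-≤ D (*-monoʳ-≤ c (step k)) ⟩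
  c * (a 0 + 2 * a k) + D        ≡⟨ solve 4 (λ c a₀ aₖ D → c :* (a₀ :+ con 2 :* aₖ) :+ D
                                              := c :* a₀ :+ con 2 :* (c :* aₖ) :+ D) refl c (a 0) (a k) D ⟩
  c * a 0 + 2 * (c * a k) + D    ≤⟨ +-monoˡ-≤ D (+-monoˡ-≤ (2 * (c * a k)) ca₀≤D) ⟩
  D + 2 * (c * a k) + D          ≡⟨ solve 2 (λ D b → D :+ con 2 :* b :+ D := con 2 :* (b :+ D)) refl D (c * a k) ⟩
  2 * (c * a k + D)              ≤⟨ *-monoʳ-≤ 2 (affine-doubling-bound a {c} ca₀≤D step k) ⟩
  2 * (2 ^ suc k * D)            ≡⟨ sym (*-assoc 2 (2 ^ suc k) D) ⟩
  2 ^ suc (suc k) * D            ∎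
  where open ≤-Reasoning

2*m<m+n⇒m+n≤2*n : ∀ m n → 2 * m < m + n → m + n ≤ 2 * n
2*m<m+n⇒m+n≤2*n m n 2m<m+n = begin
  m + n        ≤⟨ +-monoˡ-≤ n (<⇒≤ m<n) ⟩
  n + n        ≡⟨ cong (n +_) (sym (+-identityʳ n)) ⟩
  2 * n        ∎
  where
  open ≤-Reasoning
  m<n : m < n
  m<n = +-cancelˡ-< m m n (subst (_< m + n) (cong (m +_) (+-identityʳ m)) 2m<m+n)

module _ {n : ℕ} (G : SimpleGraph n) where

  upArc : Fin n → Fin n → ℕ
  upArc x y = ind ((toℕ x <ᵇ toℕ y) ∧ adj G x y)

  ind-adj≡upArc+upArc : ∀ x y → ind (adj G x y) ≡ upArc x y + upArc y x
  ind-adj≡upArc+upArc x y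
    with toℕ x <ᵇ toℕ y | <ᵇ-reflects-< (toℕ x) (toℕ y)
       | toℕ y <ᵇ toℕ x | <ᵇ-reflects-< (toℕ y) (toℕ x)
  ... | true  | ofʸ x<y | true  | ofʸ y<x = contradiction y<x (<-asym x<y)
  ... | true  | _       | false | _       = sym (+-identityʳ _)
  ... | false | _       | true  | _       = cong ind (symm G x y)
  ... | false | ofⁿ x≮y | false | ofⁿ y≮x
    with refl ← toℕ-injective (≤-antisym (≮⇒≥ y≮x) (≮⇒≥ x≮y)) = cong ind (irrefl G x)

  handshake : degSum G ≡ 2 * edges G
  handshake = begin
    sumV (λ x → sumV (λ y → ind (adj G x y)))
      ≡⟨ sumV-cong (λ x → sumV-cong (ind-adj≡upArc+upArc x)) ⟩
    sumV (λ x → sumV (λ y → upArc x y + upArc y x))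
      ≡⟨ sumV-cong (λ x → sumV-+ (upArc x) (λ y → upArc y x)) ⟩
    sumV (λ x → sumV (upArc x) + sumV (λ y → upArc y x))
      ≡⟨ sumV-+ (λ x → sumV (upArc x)) (λ x → sumV (λ y → upArc y x)) ⟩
    edges G + sumV (λ x → sumV (λ y → upArc y x))
      ≡⟨ cong (edges G +_) (sym (sumV-comm upArc)) ⟩
    edges G + edges G
      ≡⟨ cong (edges G +_) (sym (+-identityʳ _)) ⟩
    2 * edges G ∎
    where open ≡-Reasoning

module _ {n : ℕ} (G : SimpleGraph n) (h : ℕ) where

  -- Index k refers to (h,k+1)-goodness, as in goodFrom.
  badDeg : ℕ → Fin n → ℕ
  badDeg k x = if goodFrom G h k x then 0 else deg G x

  badDegSum : ℕ → ℕ
  badDegSum k = sumV (badDeg k)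

  goodNeighbours badNeighbours : ℕ → Fin n → ℕ
  goodNeighbours k x = sumV (λ y → ind (adj G x y ∧ goodFrom G h k y))
  badNeighbours  k x = sumV (λ y → ind (adj G x y ∧ not (goodFrom G h k y)))

  goodNeighbours+badNeighbours≡deg : ∀ k x →
    goodNeighbours k x + badNeighbours k x ≡ deg G x
  goodNeighbours+badNeighbours≡deg k x =
    trans (sym (sumV-+ (λ y → ind (adj G x y ∧ goodFrom G h k y)) _))
          (sumV-cong (λ y → ind-split (adj G x y) (goodFrom G h k y)))
    where
    ind-split : ∀ (a b : Bool) → ind (a ∧ b) + ind (a ∧ not b) ≡ ind a
    ind-split true  true  = refl
    ind-split true  false = refl
    ind-split false _     = refl

  sumV-badNeighbours : ∀ k → sumV (badNeighbours k) ≡ badDegSum k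
  sumV-badNeighbours k =
    trans (sumV-comm (λ x y → ind (adj G x y ∧ not (goodFrom G h k y))))
          (sumV-cong column)
    where
    column : ∀ y → sumV (λ x → ind (adj G x y ∧ not (goodFrom G h k y))) ≡ badDeg k y
    column y with goodFrom G h k y
    ... | true  = trans (sumV-cong (λ x → cong ind (∧-zeroʳ (adj G x y))))
                        (trans (sumV-const {n} 0) (*-zeroʳ n))
    ... | false = sumV-cong (λ x → cong ind (trans (∧-identityʳ (adj G x y)) (symm G x y)))

  badDeg-suc≤ : ∀ k x → badDeg (suc k) x ≤ badDeg 0 x + 2 * badNeighbours k x
  badDeg-suc≤ k x with good1 G h x
  ... | false = m≤m+n (deg G x) _
  ... | true  with deg G x ≤ᵇ 2 * goodNeighbours k x
                 | ≤ᵇ-reflects-≤ (deg G x) (2 * goodNeighbours k x)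
  ...   | true  | _         = z≤n
  ...   | false | ofⁿ d≰2g  = subst (_≤ 2 * b) g+b≡d (2*m<m+n⇒m+n≤2*n g b 2g<g+b)
    where
    g b : ℕ
    g = goodNeighbours k x
    b = badNeighbours k x
    g+b≡d : g + b ≡ deg G x
    g+b≡d = goodNeighbours+badNeighbours≡deg k x
    2g<g+b : 2 * g < g + b
    2g<g+b = subst (2 * g <_) (sym g+b≡d) (≰⇒> d≰2g)

  badDegSum-suc≤ : ∀ k → badDegSum (suc k) ≤ badDegSum 0 + 2 * badDegSum k
  badDegSum-suc≤ k = begin
    badDegSum (suc k)                                  ≤⟨ sumV-mono-≤ (badDeg-suc≤ k) ⟩
    sumV (λ x → badDeg 0 x + 2 * badNeighbours k x)    ≡⟨ sumV-+ (badDeg 0) _ ⟩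
    badDegSum 0 + sumV (λ x → 2 * badNeighbours k x)   ≡⟨ cong (badDegSum 0 +_) (sumV-*ˡ 2 (badNeighbours k)) ⟩
    badDegSum 0 + 2 * sumV (badNeighbours k)           ≡⟨ cong (λ s → badDegSum 0 + 2 * s) (sumV-badNeighbours k) ⟩
    badDegSum 0 + 2 * badDegSum k                      ∎
    where open ≤-Reasoning

  3^h*badDegSum0≤degSum : 0 < n → 3 ^ h * badDegSum 0 ≤ degSum G
  3^h*badDegSum0≤degSum 0<n = *-cancelˡ-≤ n {{>-nonZero 0<n}} (begin
    n * (3 ^ h * badDegSum 0)          ≡⟨ solve 3 (λ n p s → n :* (p :* s) := (p :* n) :* s) refl n (3 ^ h) (badDegSum 0) ⟩
    (3 ^ h * n) * badDegSum 0          ≡⟨ sym (sumV-*ˡ (3 ^ h * n) (badDeg 0)) ⟩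
    sumV (λ x → 3 ^ h * n * badDeg 0 x) ≤⟨ sumV-mono-≤ scaled-badDeg≤degSum ⟩
    sumV {n} (λ _ → degSum G)          ≡⟨ sumV-const {n} (degSum G) ⟩
    n * degSum G                       ∎)
    where
    open ≤-Reasoning
    scaled-badDeg≤degSum : ∀ x → 3 ^ h * n * badDeg 0 x ≤ degSum G
    scaled-badDeg≤degSum x
      with degSum G ≤ᵇ 3 ^ h * n * deg G x | ≤ᵇ-reflects-≤ (degSum G) (3 ^ h * n * deg G x)
    ... | true  | _        = subst (_≤ degSum G) (sym (*-zeroʳ (3 ^ h * n))) z≤n
    ... | false | ofⁿ D≰   = <⇒≤ (≰⇒> D≰)

  sumDegGood+sumDegBad≡degSum : sumDegGood G h + sumDegBad G h ≡ degSum G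
  sumDegGood+sumDegBad≡degSum =
    trans (sym (sumV-+ (λ x → if isGood G h h x then deg G x else 0) _))
          (sumV-cong (λ x → if-split (isGood G h h x) (deg G x)))
    where
    if-split : ∀ (b : Bool) (d : ℕ) → (if b then d else 0) + (if b then 0 else d) ≡ d
    if-split true  d = +-identityʳ d
    if-split false d = refl

3*sumDegBad≤degSum : ∀ {n} → 0 < n → (G : SimpleGraph n) → ∀ k →
  3 * sumDegBad G (suc k) ≤ degSum G
3*sumDegBad≤degSum 0<n G k = *-cancelˡ-≤ (3 ^ k) {{m^n≢0 3 k}} (+-cancelʳ-≤ D _ _ (begin
  3 ^ k * (3 * B) + D   ≡⟨ cong (_+ D) (sym (*-assoc (3 ^ k) 3 B)) ⟩
  3 ^ k * 3 * B + D     ≡⟨ cong (λ p → p * B + D) (*-comm (3 ^ k) 3) ⟩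
  3 ^ suc k * B + D     ≤⟨ affine-doubling-bound (badDegSum G (suc k)) {3 ^ suc k} (3^h*badDegSum0≤degSum G (suc k) 0<n)
                                                 (badDegSum-suc≤ G (suc k)) k ⟩
  2 ^ suc k * D         ≤⟨ *-monoˡ-≤ D (2^[1+k]≤3^k+1 k) ⟩
  (3 ^ k + 1) * D       ≡⟨ trans (*-distribʳ-+ D (3 ^ k) 1) (cong (3 ^ k * D +_) (*-identityˡ D)) ⟩
  3 ^ k * D + D         ∎))
  where
  open ≤-Reasoning
  D B : ℕ
  D = degSum G
  B = sumDegBad G (suc k)

lemma3p3 : (n : ℕ) → 0 < n → (G : SimpleGraph n) → (h : ℕ) → 1 ≤ h →
    (3 * sumDegBad G h ≤ 2 * edges G) × (4 * edges G ≤ 3 * sumDegGood G h)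
lemma3p3 n 0<n G (suc k) _ = 3B≤2e , 4e≤3A
  where
  e A B : ℕ
  e = edges G
  A = sumDegGood G (suc k)
  B = sumDegBad G (suc k)

  A+B≡2e : A + B ≡ 2 * e
  A+B≡2e = trans (sumDegGood+sumDegBad≡degSum G (suc k)) (handshake G)

  3B≤2e : 3 * B ≤ 2 * e
  3B≤2e = subst (3 * B ≤_) (handshake G) (3*sumDegBad≤degSum 0<n G k)

  4e≤3A : 4 * e ≤ 3 * A
  4e≤3A = +-cancelʳ-≤ (2 * e) _ _ (begin
    4 * e + 2 * e   ≡⟨ solve 1 (λ e → con 4 :* e :+ con 2 :* e := con 3 :* (con 2 :* e)) refl e ⟩
    3 * (2 * e)     ≡⟨ cong (3 *_) (sym A+B≡2e) ⟩
    3 * (A + B)     ≡⟨ *-distribˡ-+ 3 A B ⟩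
    3 * A + 3 * B   ≤⟨ +-monoʳ-≤ (3 * A) 3B≤2e ⟩
    3 * A + 2 * e   ∎)
    where open ≤-Reasoning
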